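{- There exists a family $(\mu_n)_{n\ge 0}$ of Presburger arithmetic specifications, where $\mu_n$ has size polynomial in $n$, such that for every $n$, every Presburger circuit computing any Skolem function for $\mu_n$ has size at least $2^{\Omega(n)}$.
   Context: A Presburger arithmetic specification is a quantifier-free formula $\varphi(\bar{x},\bar{y})$ over $\langle\mathbb{Z};+,<,0,1\rangle$ extended with modulo constraints $\sum_i a_ix_i\equiv r\pmod M$, with variables partitioned into inputs $\bar{x}$ and outputs $\bar{y}$, constants in binary. A Skolem function for it is a function $f$ from $\mathbb{Z}^{|\bar{x}|}$ to $\mathbb{Z}^{|\bar{y}|}$ such that for every $\bar{u}$, if $\varphi(\bar{u},\bar{v})$ holds for some $\bar{v}$ then $\varphi(\bar{u},f(\bar{u}))$ holds. A Presburger circuit is a circuit with input gates for $\bar{x}$ whose other gates compute affine functions with integer coefficients of their inputs, $\max(x,y)$, $\mathsf{E}(x,y)$ ($=y$ if $x=0$, else $0$), or $\mathsf{div}_m(x)=\lfloor x/m\rfloor$ for nonzero integer constants $m$; its size is measured with constants in binary. -}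

module Defs where

open import Data.Nat as ℕ using (ℕ; zero; suc)
open import Data.Nat.Logarithm using (⌈log₂_⌉)
open import Data.Integer as ℤ using (ℤ; +_; -[1+_]; ∣_∣; _/ℕ_)
open import Data.Integer.Divisibility using (_∣_)
open import Data.Fin using (Fin; zero; suc)
open import Data.Sum using (_⊎_; inj₁; inj₂)
open import Data.Product using (Σ; ∃; _×_; _,_)
open import Data.List using (List; []; _∷_)
open import Data.Unit using (⊤)
open import Data.Empty using (⊥)
open import Relation.Nullary using (¬_)
open import Relation.Binary.PropositionalEquality using (_≡_; _≢_)

bitsℕ : ℕ → ℕ
bitsℕ n = suc ⌈log₂ (suc n) ⌉

-- size of an integer constant written in binary (sign bit + bits of |z|)
bitsℤ : ℤ → ℕ
bitsℤ z = suc (bitsℕ ∣ z ∣)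

data Term (V : Set) : Set where
  var   : V → Term V
  const : ℤ → Term V
  _⊕_   : Term V → Term V → Term V
  scale : ℤ → Term V → Term V

data Formula (V : Set) : Set where
  tt ff : Formula V
  _<ᶠ_  : Term V → Term V → Formula V
  _=ᶠ_  : Term V → Term V → Formula V
  modc  : Term V → (r : ℤ) → (M : ℕ) → Formula V
  ¬ᶠ_   : Formula V → Formula V
  _∧ᶠ_  : Formula V → Formula V → Formula V
  _∨ᶠ_  : Formula V → Formula V → Formula V

⟦_⟧ᵗ : ∀ {V} → Term V → (V → ℤ) → ℤ
⟦ var x ⟧ᵗ ρ     = ρ x
⟦ const c ⟧ᵗ ρ   = c
⟦ s ⊕ t ⟧ᵗ ρ     = ⟦ s ⟧ᵗ ρ ℤ.+ ⟦ t ⟧ᵗ ρ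
⟦ scale c t ⟧ᵗ ρ = c ℤ.* ⟦ t ⟧ᵗ ρ

⟦_⟧ᶠ : ∀ {V} → Formula V → (V → ℤ) → Set
⟦ tt ⟧ᶠ ρ         = ⊤
⟦ ff ⟧ᶠ ρ         = ⊥
⟦ s <ᶠ t ⟧ᶠ ρ     = ⟦ s ⟧ᵗ ρ ℤ.< ⟦ t ⟧ᵗ ρ
⟦ s =ᶠ t ⟧ᶠ ρ     = ⟦ s ⟧ᵗ ρ ≡ ⟦ t ⟧ᵗ ρ
⟦ modc t r M ⟧ᶠ ρ = + M ∣ (⟦ t ⟧ᵗ ρ ℤ.- r)
⟦ ¬ᶠ φ ⟧ᶠ ρ       = ¬ ⟦ φ ⟧ᶠ ρ
⟦ φ ∧ᶠ ψ ⟧ᶠ ρ     = ⟦ φ ⟧ᶠ ρ × ⟦ ψ ⟧ᶠ ρ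
⟦ φ ∨ᶠ ψ ⟧ᶠ ρ     = ⟦ φ ⟧ᶠ ρ ⊎ ⟦ ψ ⟧ᶠ ρ

termSize : ∀ {V} → Term V → ℕ
termSize (var x)     = 1
termSize (const c)   = bitsℤ c
termSize (s ⊕ t)     = suc (termSize s ℕ.+ termSize t)
termSize (scale c t) = suc (bitsℤ c ℕ.+ termSize t)

formulaSize : ∀ {V} → Formula V → ℕ
formulaSize tt           = 1
formulaSize ff           = 1
formulaSize (s <ᶠ t)     = suc (termSize s ℕ.+ termSize t)
formulaSize (s =ᶠ t)     = suc (termSize s ℕ.+ termSize t)
formulaSize (modc t r M) = suc (termSize t ℕ.+ bitsℤ r ℕ.+ bitsℕ M)
formulaSize (¬ᶠ φ)       = suc (formulaSize φ)
formulaSize (φ ∧ᶠ ψ)     = suc (formulaSize φ ℕ.+ formulaSize ψ)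
formulaSize (φ ∨ᶠ ψ)     = suc (formulaSize φ ℕ.+ formulaSize ψ)

record Spec : Set where
  field
    nIn nOut : ℕ
    φ        : Formula (Fin nIn ⊎ Fin nOut)

specSize : Spec → ℕ
specSize S = Spec.nIn S ℕ.+ Spec.nOut S ℕ.+ formulaSize (Spec.φ S)

holds : (S : Spec) → (Fin (Spec.nIn S) → ℤ) → (Fin (Spec.nOut S) → ℤ) → Set
holds S u v = ⟦ Spec.φ S ⟧ᶠ env
  where
  env : Fin (Spec.nIn S) ⊎ Fin (Spec.nOut S) → ℤ
  env (inj₁ i) = u i
  env (inj₂ j) = v j

IsSkolem : (S : Spec) → ((Fin (Spec.nIn S) → ℤ) → (Fin (Spec.nOut S) → ℤ)) → Set
IsSkolem S f = ∀ u → (∃ λ v → holds S u v) → holds S u (f u)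

-- floor division ⌊x / m⌋ for m ≠ 0 (stdlib _/ℕ_ is floor division by a positive)
divFloor : ℤ → ℤ → ℤ
divFloor x (+ zero)    = + 0        -- never used: gates require m ≢ 0
divFloor x (+ (suc d)) = x /ℕ suc d
divFloor x -[1+ d ]    = (ℤ.- x) /ℕ suc d

E : ℤ → ℤ → ℤ
E (+ zero) y = y
E _        y = + 0

data Gate (w : ℕ) : Set where
  affine : List (ℤ × Fin w) → ℤ → Gate w
  maxg   : Fin w → Fin w → Gate w
  Eg     : Fin w → Fin w → Gate w
  divg   : (m : ℤ) → m ≢ + 0 → Fin w → Gate w

gateSize : ∀ {w} → Gate w → ℕ
gateSize (affine as b) = suc (go as ℕ.+ bitsℤ b)
  where
  go : List (ℤ × _) → ℕ
  go []            = 0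
  go ((a , _) ∷ r) = suc (bitsℤ a ℕ.+ go r)
gateSize (maxg _ _)    = 1
gateSize (Eg _ _)      = 1
gateSize (divg m _ _)  = suc (bitsℤ m)

gateEval : ∀ {w} → Gate w → (Fin w → ℤ) → ℤ
gateEval (affine as b) ρ = go as
  where
  go : List (ℤ × _) → ℤ
  go []            = b
  go ((a , i) ∷ r) = a ℤ.* ρ i ℤ.+ go r
gateEval (maxg i j) ρ   = ρ i ℤ.⊔ ρ j
gateEval (Eg i j) ρ     = E (ρ i) (ρ j)
gateEval (divg m _ i) ρ = divFloor (ρ i) m

-- a sequence of gates on top of k input gates; Gates k w has w wires in total
data Gates (k : ℕ) : ℕ → Set where
  inputs : Gates k k
  _▷_    : ∀ {w} → Gates k w → Gate w → Gates k (suc w)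

-- newest wire is zero, older wires are suc
extend : ∀ {w} → (Fin w → ℤ) → ℤ → Fin (suc w) → ℤ
extend ρ x zero    = x
extend ρ x (suc i) = ρ i

wires : ∀ {k w} → Gates k w → (Fin k → ℤ) → Fin w → ℤ
wires inputs   u = u
wires (gs ▷ g) u = extend (wires gs u) (gateEval g (wires gs u))

gatesSize : ∀ {k w} → Gates k w → ℕ
gatesSize inputs   = 0
gatesSize (gs ▷ g) = gatesSize gs ℕ.+ gateSize g

record Circuit (k l : ℕ) : Set where
  field
    nWires : ℕ
    gates  : Gates k nWires
    out    : Fin l → Fin nWires

circuitSize : ∀ {k l} → Circuit k l → ℕ
circuitSize {k} C = k ℕ.+ gatesSize (Circuit.gates C)

evalCircuit : ∀ {k l} → Circuit k l → (Fin k → ℤ) → Fin l → ℤ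
evalCircuit C u j = wires (Circuit.gates C) u (Circuit.out C j)

{-# OPTIONS --safe #-}

-- divisionSpec K has inputs x, b₀ … b_{K-1} and outputs y, z₀ … z_{K-1}; it forces the bᵢ to be
-- bits, zᵢ = bᵢ·y and (1 + J)·y ≤ x < (1 + J)·(y + 1) for J = Σ 2ⁱ·bᵢ, so every Skolem function
-- outputs ⌊x / (1 + J)⌋.  Let P be the product of the moduli |m| of the div gates of a circuit.
-- Along the inputs x = P·t every wire is an eventually affine function of t: affine gates, max
-- and E preserve this, and div_m does because the rescaling built into P makes slopes divisible
-- by m.  As t ↦ ⌊P·t / d⌋ is eventually affine only when d ∣ P, P is a common multiple of
-- 1, …, 2^K.  Such a number is at least 2^(2^(K-2)), because (2m+1)! divides M·m!·m! for every
-- common multiple M of 1, …, 2m+1; on the other hand P ≤ 2^(circuit size).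

module Submission where

open import Defs

module FloorDivision where

  open import Data.Nat using (NonZero)
  open import Data.Integer using (+_; 1ℤ; _+_; _*_; _≤_; _<_; _/ℕ_)
  import Data.Integer as ℤ using (suc)
  open import Data.Integer.Properties
    using ( ≤-antisym; ≤-<-trans; pred-suc; i<j⇒i≤pred[j]; *-cancelʳ-<-nonNeg; *-distribʳ-+
          ; +-monoʳ-≤; +-monoʳ-<; module ≤-Reasoning)
  open import Data.Integer.DivMod using ([n/ℕd]*d≤n; n<s[n/ℕd]*d)
  open import Data.Integer.Tactic.RingSolver using (solve-∀)
  open import Relation.Binary.PropositionalEquality using (_≡_; subst)

  /ℕ-unique : ∀ {q} n d .{{_ : NonZero d}} → q * + d ≤ n → n < ℤ.suc q * + d → n /ℕ d ≡ q
  /ℕ-unique n d lo hi = ≤-antisym (quotient-≤ ([n/ℕd]*d≤n n d) hi) (quotient-≤ lo (n<s[n/ℕd]*d n d))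
    where
    quotient-≤ : ∀ {q q′} → q * + d ≤ n → n < ℤ.suc q′ * + d → q ≤ q′
    quotient-≤ {q} {q′} lo hi =
      subst (q ≤_) (pred-suc q′) (i<j⇒i≤pred[j] (*-cancelʳ-<-nonNeg {j = ℤ.suc q′} (+ d) (≤-<-trans lo hi)))

  [i*d+n]/ℕd≡i+n/ℕd : ∀ i n d .{{_ : NonZero d}} → (i * + d + n) /ℕ d ≡ i + n /ℕ d
  [i*d+n]/ℕd≡i+n/ℕd i n d = /ℕ-unique (i * + d + n) d lower upper
    where
    open ≤-Reasoning
    q = n /ℕ d
    regroup : ∀ i q d → i * d + (1ℤ + q) * d ≡ (1ℤ + (i + q)) * d
    regroup = solve-∀
    lower : (i + q) * + d ≤ i * + d + n
    lower = begin
      (i + q) * + d         ≡⟨ *-distribʳ-+ (+ d) i q ⟩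
      i * + d + q * + d     ≤⟨ +-monoʳ-≤ (i * + d) ([n/ℕd]*d≤n n d) ⟩
      i * + d + n           ∎
    upper : i * + d + n < ℤ.suc (i + q) * + d
    upper = begin-strict
      i * + d + n             <⟨ +-monoʳ-< (i * + d) (n<s[n/ℕd]*d n d) ⟩
      i * + d + ℤ.suc q * + d ≡⟨ regroup i q (+ d) ⟩
      ℤ.suc (i + q) * + d     ∎

module EventuallyAffineFunctions where

  open FloorDivision

  open import Data.Nat as ℕ using (ℕ; zero; suc; NonZero)
  import Data.Nat.Properties as ℕ
  open import Data.Nat.Divisibility using (_∣_; divides)
  open import Data.Integer
    using (ℤ; +_; -[1+_]; +[1+_]; 0ℤ; ∣_∣; _+_; _-_; -_; _*_; _⊔_; _<_; _/ℕ_; +<+; -<+)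
  import Data.Integer as ℤ using (suc)
  open import Data.Integer.Properties
  open import Data.Integer.Tactic.RingSolver using (solve-∀)
  import Data.Nat.Tactic.RingSolver as ℕ-Solver
  open import Algebra.Properties.AbelianGroup +-0-abelianGroup using (∙-cancelʳ)
  open import Data.Product using (∃; ∃₂; _×_; _,_)
  open import Data.Sum as Sum using (_⊎_; inj₁; inj₂)
  open import Data.Empty using (⊥-elim)
  open import Relation.Binary.Definitions using (tri<; tri≈; tri>)
  open import Relation.Binary.PropositionalEquality

  private variable
    P Q : ℕ → Set
    f g : ℕ → ℤ

  Eventually : (ℕ → Set) → Set
  Eventually P = ∃ λ T → ∀ t → T ℕ.≤ t → P t

  always : (∀ t → P t) → Eventually P
  always p = 0 , λ t _ → p t

  eventually-map : (∀ {t} → P t → Q t) → Eventually P → Eventually Q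
  eventually-map p⇒q (T , p) = T , λ t T≤t → p⇒q (p t T≤t)

  eventually-× : Eventually P → Eventually Q → Eventually (λ t → P t × Q t)
  eventually-× (T , p) (T′ , q) =
    T ℕ.⊔ T′ , λ t le → p t (ℕ.m⊔n≤o⇒m≤o T T′ le) , q t (ℕ.m⊔n≤o⇒n≤o T T′ le)

  eventually-∘-* : ∀ c .{{_ : NonZero c}} → Eventually P → Eventually (λ t → P (c ℕ.* t))
  eventually-∘-* c (T , p) = T , λ t T≤t → p (c ℕ.* t) (ℕ.≤-trans T≤t (ℕ.m≤n*m t c))

  eventually-exceeds : ∀ γ → Eventually (λ t → γ < + t)
  eventually-exceeds (+ g)    = suc g , λ t g<t → +<+ g<t
  eventually-exceeds -[1+ g ] = always λ t → -<+

  affineMap : ℤ → ℤ → ℕ → ℤ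
  affineMap α β t = α * + t + β

  EventuallyAffine : (ℕ → ℤ) → Set
  EventuallyAffine f = ∃₂ λ α β → Eventually (λ t → f t ≡ affineMap α β t)

  EventuallyComparable : (ℕ → ℤ) → (ℕ → ℤ) → Set
  EventuallyComparable f g =
    Eventually (λ t → f t < g t) ⊎ Eventually (λ t → g t < f t) ⊎ Eventually (λ t → f t ≡ g t)

  steeper-eventually-greater : ∀ {α α′} → α < α′ → ∀ β β′ →
                               Eventually (λ t → affineMap α β t < affineMap α′ β′ t)
  steeper-eventually-greater {α} {α′} α<α′ β β′ = eventually-map below (eventually-exceeds (β - β′))
    where
    shift : ∀ α β β′ t → α * t + β ≡ (β - β′) + (α * t + β′)
    shift = solve-∀
    expand : ∀ α β′ t → t + (α * t + β′) ≡ (+ 1 + α) * t + β′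
    expand = solve-∀
    below : ∀ {t} → β - β′ < + t → affineMap α β t < affineMap α′ β′ t
    below {t} lt = begin-strict
      α * + t + β               ≡⟨ shift α β β′ (+ t) ⟩
      (β - β′) + (α * + t + β′) <⟨ +-monoˡ-< _ lt ⟩
      + t + (α * + t + β′)      ≡⟨ expand α β′ (+ t) ⟩
      ℤ.suc α * + t + β′        ≤⟨ +-monoˡ-≤ β′ (*-monoʳ-≤-nonNeg (+ t) (i<j⇒suc[i]≤j α<α′)) ⟩
      α′ * + t + β′             ∎
      where open ≤-Reasoning

  affineMap-eventuallyComparable : ∀ α β α′ β′ → EventuallyComparable (affineMap α β) (affineMap α′ β′)
  affineMap-eventuallyComparable α β α′ β′ with <-cmp α α′ | <-cmp β β′
  ... | tri< α<α′ _ _ | _             = inj₁ (steeper-eventually-greater α<α′ β β′)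
  ... | tri> _ _ α′<α | _             = inj₂ (inj₁ (steeper-eventually-greater α′<α β′ β))
  ... | tri≈ _ refl _ | tri< β<β′ _ _ = inj₁ (always λ t → +-monoʳ-< (α * + t) β<β′)
  ... | tri≈ _ refl _ | tri> _ _ β′<β = inj₂ (inj₁ (always λ t → +-monoʳ-< (α * + t) β′<β))
  ... | tri≈ _ refl _ | tri≈ _ refl _ = inj₂ (inj₂ (always λ t → refl))

  eventuallyAffine-cong : Eventually (λ t → f t ≡ g t) → EventuallyAffine f → EventuallyAffine g
  eventuallyAffine-cong f≡g (α , β , f≈) =
    α , β , eventually-map (λ (f≡g , f≡) → trans (sym f≡g) f≡) (eventually-× f≡g f≈)

  eventuallyAffine-comparable : EventuallyAffine f → EventuallyAffine g → EventuallyComparable f g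
  eventuallyAffine-comparable {f} {g} (α , β , f≈) (α′ , β′ , g≈) =
    Sum.map (transfer _<_) (Sum.map (transfer (λ a b → b < a)) (transfer _≡_))
            (affineMap-eventuallyComparable α β α′ β′)
    where
    transfer : (R : ℤ → ℤ → Set) → Eventually (λ t → R (affineMap α β t) (affineMap α′ β′ t)) →
               Eventually (λ t → R (f t) (g t))
    transfer R r = eventually-map (λ ((f≡ , g≡) , r) → subst₂ R (sym f≡) (sym g≡) r)
                                  (eventually-× (eventually-× f≈ g≈) r)

  const-eventuallyAffine : ∀ c → EventuallyAffine (λ _ → c)
  const-eventuallyAffine c = 0ℤ , c , always λ t → sym (+-identityˡ c)

  affineMap-∘-* : ∀ α β c t → affineMap α β (c ℕ.* t) ≡ affineMap (α * + c) β t
  affineMap-∘-* α β c t = trans (cong (λ s → α * s + β) (pos-* c t))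
                                (cong (_+ β) (sym (*-assoc α (+ c) (+ t))))

  eventuallyAffine-∘-* : ∀ c .{{_ : NonZero c}} → EventuallyAffine f → EventuallyAffine (λ t → f (c ℕ.* t))
  eventuallyAffine-∘-* c (α , β , f≈) =
    α * + c , β , eventually-map (λ {t} f≡ → trans f≡ (affineMap-∘-* α β c t)) (eventually-∘-* c f≈)

  eventuallyAffine-*+ : ∀ a → EventuallyAffine f → EventuallyAffine g →
                        EventuallyAffine (λ t → a * f t + g t)
  eventuallyAffine-*+ {f} {g} a (α , β , f≈) (α′ , β′ , g≈) =
    a * α + α′ , a * β + β′ , eventually-map combine (eventually-× f≈ g≈)
    where
    collect : ∀ a α β α′ β′ t → a * (α * t + β) + (α′ * t + β′) ≡ (a * α + α′) * t + (a * β + β′)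
    collect = solve-∀
    combine : ∀ {t} → f t ≡ affineMap α β t × g t ≡ affineMap α′ β′ t →
              a * f t + g t ≡ affineMap (a * α + α′) (a * β + β′) t
    combine {t} (f≡ , g≡) = trans (cong₂ (λ x y → a * x + y) f≡ g≡) (collect a α β α′ β′ (+ t))

  eventuallyAffine-⊔ : EventuallyAffine f → EventuallyAffine g → EventuallyAffine (λ t → f t ⊔ g t)
  eventuallyAffine-⊔ F G with eventuallyAffine-comparable F G
  ... | inj₁ f<g        = eventuallyAffine-cong (eventually-map (λ lt → sym (i≤j⇒i⊔j≡j (<⇒≤ lt))) f<g) G
  ... | inj₂ (inj₁ g<f) = eventuallyAffine-cong (eventually-map (λ lt → sym (i≥j⇒i⊔j≡i (<⇒≤ lt))) g<f) F
  ... | inj₂ (inj₂ f≡g) =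
    eventuallyAffine-cong (eventually-map (λ eq → sym (trans (cong (_⊔ _) eq) (⊔-idem _))) f≡g) G

  E-≢0 : ∀ {x} y → x ≢ 0ℤ → E x y ≡ 0ℤ
  E-≢0 {+ zero}     _ x≢0 = ⊥-elim (x≢0 refl)
  E-≢0 {+[1+ _ ]}   _ _   = refl
  E-≢0 { -[1+ _ ] } _ _   = refl

  eventuallyAffine-E : EventuallyAffine f → EventuallyAffine g → EventuallyAffine (λ t → E (f t) (g t))
  eventuallyAffine-E F G with eventuallyAffine-comparable F (const-eventuallyAffine 0ℤ)
  ... | inj₁ f<0        = eventuallyAffine-cong (eventually-map (λ lt → sym (E-≢0 _ (<⇒≢ lt))) f<0)
                                                (const-eventuallyAffine 0ℤ)
  ... | inj₂ (inj₁ 0<f) = eventuallyAffine-cong (eventually-map (λ lt → sym (E-≢0 _ (≢-sym (<⇒≢ lt)))) 0<f)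
                                                (const-eventuallyAffine 0ℤ)
  ... | inj₂ (inj₂ f≡0) = eventuallyAffine-cong (eventually-map (λ eq → sym (cong (λ x → E x _) eq)) f≡0) G

  affineMap-/ℕ : ∀ α β d .{{_ : NonZero d}} t → affineMap (α * + d) β t /ℕ d ≡ affineMap α (β /ℕ d) t
  affineMap-/ℕ α β d t =
    trans (cong (_/ℕ d) (swap α (+ d) (+ t) β)) ([i*d+n]/ℕd≡i+n/ℕd (α * + t) β d)
    where
    swap : ∀ α d t β → α * d * t + β ≡ α * t * d + β
    swap = solve-∀

  eventuallyAffine-divFloor : ∀ m → m ≢ 0ℤ → EventuallyAffine f →
                              EventuallyAffine (λ t → divFloor (f (∣ m ∣ ℕ.* t)) m)
  eventuallyAffine-divFloor (+ zero) m≢0 _ = ⊥-elim (m≢0 refl)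
  eventuallyAffine-divFloor {f} +[1+ d ] _ (α , β , f≈) =
    α , β /ℕ suc d , eventually-map quotient (eventually-∘-* (suc d) f≈)
    where
    quotient : ∀ {t} → f (suc d ℕ.* t) ≡ affineMap α β (suc d ℕ.* t) →
               f (suc d ℕ.* t) /ℕ suc d ≡ affineMap α (β /ℕ suc d) t
    quotient {t} eq = trans (cong (_/ℕ suc d) (trans eq (affineMap-∘-* α β (suc d) t)))
                            (affineMap-/ℕ α β (suc d) t)
  eventuallyAffine-divFloor {f} -[1+ d ] _ (α , β , f≈) =
    - α , (- β) /ℕ suc d , eventually-map quotient (eventually-∘-* (suc d) f≈)
    where
    negate : ∀ α c t β → - (α * c * t + β) ≡ (- α) * c * t + (- β)
    negate = solve-∀
    quotient : ∀ {t} → f (suc d ℕ.* t) ≡ affineMap α β (suc d ℕ.* t) →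
               (- f (suc d ℕ.* t)) /ℕ suc d ≡ affineMap (- α) ((- β) /ℕ suc d) t
    quotient {t} eq =
      trans (cong (λ x → (- x) /ℕ suc d) (trans eq (affineMap-∘-* α β (suc d) t)))
            (trans (cong (_/ℕ suc d) (negate α (+ suc d) (+ t) β)) (affineMap-/ℕ (- α) (- β) (suc d) t))

  -- Compare t = T with t = T + d: the floor grows by c, the affine map by α·d.
  floor-eventuallyAffine⇒∣ : ∀ c d .{{_ : NonZero d}} → EventuallyAffine (λ t → + (c ℕ.* t) /ℕ d) → d ∣ c
  floor-eventuallyAffine⇒∣ c d (α , β , T , floor≈) =
    divides ∣ α ∣ (trans (cong ∣_∣ c≡α*d) (abs-* α (+ d)))
    where
    open ≡-Reasoning
    split : ∀ c t d → c ℕ.* (t ℕ.+ d) ≡ c ℕ.* d ℕ.+ c ℕ.* t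
    split = ℕ-Solver.solve-∀
    regroup : ∀ α t d β → α * (t + d) + β ≡ α * d + (α * t + β)
    regroup = solve-∀
    floor-step : + (c ℕ.* (T ℕ.+ d)) /ℕ d ≡ + c + + (c ℕ.* T) /ℕ d
    floor-step = begin
      + (c ℕ.* (T ℕ.+ d)) /ℕ d             ≡⟨ cong (λ n → + n /ℕ d) (split c T d) ⟩
      + (c ℕ.* d ℕ.+ c ℕ.* T) /ℕ d         ≡⟨ cong (_/ℕ d) (trans (pos-+ (c ℕ.* d) _)
                                                               (cong (_+ _) (pos-* c d))) ⟩
      (+ c * + d + + (c ℕ.* T)) /ℕ d       ≡⟨ [i*d+n]/ℕd≡i+n/ℕd (+ c) (+ (c ℕ.* T)) d ⟩
      + c + + (c ℕ.* T) /ℕ d               ∎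
    affine-step : affineMap α β (T ℕ.+ d) ≡ α * + d + affineMap α β T
    affine-step = trans (cong (λ s → α * s + β) (pos-+ T d)) (regroup α (+ T) (+ d) β)
    c≡α*d : + c ≡ α * + d
    c≡α*d = ∙-cancelʳ (affineMap α β T) (+ c) (α * + d) (begin
      + c + affineMap α β T                ≡⟨ cong (_+_ (+ c)) (floor≈ T ℕ.≤-refl) ⟨
      + c + + (c ℕ.* T) /ℕ d               ≡⟨ floor-step ⟨
      + (c ℕ.* (T ℕ.+ d)) /ℕ d             ≡⟨ floor≈ (T ℕ.+ d) (ℕ.m≤m+n T d) ⟩
      affineMap α β (T ℕ.+ d)              ≡⟨ affine-step ⟩
      α * + d + affineMap α β T            ∎)

module CircuitsAlongRays where

  open EventuallyAffineFunctions
  open import Data.Nat as ℕ using (ℕ; zero; suc; NonZero; _+_; _*_; _^_; _≤_; z≤n; s≤s; ⌈_/2⌉)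
  import Data.Nat.Properties as ℕ
  open import Data.Nat.Tactic.RingSolver using (solve-∀)
  open import Data.Nat.Logarithm using (⌈log₂_⌉)
  open import Data.Nat.Logarithm.Core using (⌈log2⌉)
  open import Data.Nat.Induction using (<-wellFounded)
  open import Induction.WellFounded using (Acc; acc)
  open import Data.Integer using (ℤ; +_; +[1+_]; -[1+_]; ∣_∣)
  open import Data.Fin using (Fin; zero; suc)
  open import Data.List using ([]; _∷_)
  open import Data.Product using (_,_)
  open import Data.Empty using (⊥-elim)
  open import Relation.Binary.PropositionalEquality
  open ℕ.≤-Reasoning

  private variable
    k w : ℕ

  gateModulus : Gate w → ℕ
  gateModulus (divg m _ _) = ∣ m ∣
  gateModulus _            = 1

  modulus : Gates k w → ℕ
  modulus inputs   = 1
  modulus (gs ▷ g) = modulus gs * gateModulus g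

  gateModulus-nonZero : (g : Gate w) → NonZero (gateModulus g)
  gateModulus-nonZero (affine _ _)          = _
  gateModulus-nonZero (maxg _ _)            = _
  gateModulus-nonZero (Eg _ _)              = _
  gateModulus-nonZero (divg (+ zero) m≢0 _) = ⊥-elim (m≢0 refl)
  gateModulus-nonZero (divg +[1+ _ ] _ _)   = _
  gateModulus-nonZero (divg -[1+ _ ] _ _)   = _

  modulus-nonZero : (gs : Gates k w) → NonZero (modulus gs)
  modulus-nonZero inputs   = _
  modulus-nonZero (gs ▷ g) = ℕ.m*n≢0 _ _ {{modulus-nonZero gs}} {{gateModulus-nonZero g}}

  affineGate-eventuallyAffine : ∀ as b {ρ : ℕ → Fin w → ℤ} → (∀ i → EventuallyAffine (λ t → ρ t i)) →
                                EventuallyAffine (λ t → gateEval (affine as b) (ρ t))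
  affineGate-eventuallyAffine []             b ρ≈ = const-eventuallyAffine b
  affineGate-eventuallyAffine ((a , i) ∷ as) b ρ≈ =
    eventuallyAffine-*+ a (ρ≈ i) (affineGate-eventuallyAffine as b ρ≈)

  -- gateModulus is 1 away from div gates, and 1 * t is not definitionally t.
  eventuallyAffine-∘-1* : {ρ : ℕ → Fin w → ℤ} → (∀ i → EventuallyAffine (λ t → ρ t i)) →
                          ∀ i → EventuallyAffine (λ t → ρ (1 * t) i)
  eventuallyAffine-∘-1* ρ≈ i = eventuallyAffine-∘-* 1 (ρ≈ i)

  gateEval-eventuallyAffine : (g : Gate w) {ρ : ℕ → Fin w → ℤ} → (∀ i → EventuallyAffine (λ t → ρ t i)) →
                              EventuallyAffine (λ t → gateEval g (ρ (gateModulus g * t)))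
  gateEval-eventuallyAffine (affine as b)  ρ≈ = affineGate-eventuallyAffine as b (eventuallyAffine-∘-1* ρ≈)
  gateEval-eventuallyAffine (maxg i j)     ρ≈ =
    eventuallyAffine-⊔ (eventuallyAffine-∘-1* ρ≈ i) (eventuallyAffine-∘-1* ρ≈ j)
  gateEval-eventuallyAffine (Eg i j)       ρ≈ =
    eventuallyAffine-E (eventuallyAffine-∘-1* ρ≈ i) (eventuallyAffine-∘-1* ρ≈ j)
  gateEval-eventuallyAffine (divg m m≢0 i) ρ≈ = eventuallyAffine-divFloor m m≢0 (ρ≈ i)

  wires-eventuallyAffine : (gs : Gates k w) {u : ℕ → Fin k → ℤ} → (∀ i → EventuallyAffine (λ t → u t i)) →
                           ∀ i → EventuallyAffine (λ t → wires gs (u (modulus gs * t)) i)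
  wires-eventuallyAffine inputs       u≈ = eventuallyAffine-∘-1* u≈
  wires-eventuallyAffine (gs ▷ g) {u} u≈ i = eventuallyAffine-cong (always reassociate) (extended i)
    where
    ρ≈ = wires-eventuallyAffine gs u≈
    reassociate : ∀ t → wires (gs ▷ g) (u (modulus gs * (gateModulus g * t))) i ≡
                        wires (gs ▷ g) (u (modulus gs * gateModulus g * t)) i
    reassociate t = cong (λ s → wires (gs ▷ g) (u s) i) (sym (ℕ.*-assoc (modulus gs) (gateModulus g) t))
    extended : ∀ i → EventuallyAffine (λ t → wires (gs ▷ g) (u (modulus gs * (gateModulus g * t))) i)
    extended zero    = gateEval-eventuallyAffine g ρ≈
    extended (suc i) = eventuallyAffine-∘-* (gateModulus g) {{gateModulus-nonZero g}} (ρ≈ i)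

  n≤2^⌈log2⌉n : ∀ n (rec : Acc ℕ._<_ n) → n ≤ 2 ^ ⌈log2⌉ n rec
  n≤2^⌈log2⌉n 0             _        = z≤n
  n≤2^⌈log2⌉n 1             _        = s≤s z≤n
  n≤2^⌈log2⌉n (suc (suc n)) (acc rs) = begin
    2 + n                               ≤⟨ s≤s (s≤s n≤h+h) ⟩
    2 + (h + h)                         ≡⟨ double h ⟩
    2 * suc h                           ≤⟨ ℕ.*-monoʳ-≤ 2 (n≤2^⌈log2⌉n (suc h) _) ⟩
    2 * 2 ^ ⌈log2⌉ (suc h) _            ∎
    where
    h = ⌈ n /2⌉
    n≤h+h : n ≤ h + h
    n≤h+h = subst (_≤ h + h) (ℕ.⌊n/2⌋+⌈n/2⌉≡n n) (ℕ.+-monoˡ-≤ h (ℕ.⌊n/2⌋≤⌈n/2⌉ n))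
    double : ∀ h → 2 + (h + h) ≡ 2 * suc h
    double = solve-∀

  n≤2^⌈log₂n⌉ : ∀ n → n ≤ 2 ^ ⌈log₂ n ⌉
  n≤2^⌈log₂n⌉ n = n≤2^⌈log2⌉n n (<-wellFounded n)

  gateModulus≤2^gateSize : (g : Gate w) → gateModulus g ≤ 2 ^ gateSize g
  gateModulus≤2^gateSize g@(affine _ _) = ℕ.m^n>0 2 (gateSize g)
  gateModulus≤2^gateSize (maxg _ _)      = ℕ.m^n>0 2 1
  gateModulus≤2^gateSize (Eg _ _)        = ℕ.m^n>0 2 1
  gateModulus≤2^gateSize (divg m _ _)    = begin
    ∣ m ∣                               ≤⟨ ℕ.n≤1+n ∣ m ∣ ⟩
    suc ∣ m ∣                           ≤⟨ n≤2^⌈log₂n⌉ (suc ∣ m ∣) ⟩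
    2 ^ ⌈log₂ suc ∣ m ∣ ⌉               ≤⟨ ℕ.^-monoʳ-≤ 2 (ℕ.m≤n+m ⌈log₂ suc ∣ m ∣ ⌉ 3) ⟩
    2 ^ (3 + ⌈log₂ suc ∣ m ∣ ⌉)         ∎

  modulus≤2^gatesSize : (gs : Gates k w) → modulus gs ≤ 2 ^ gatesSize gs
  modulus≤2^gatesSize inputs   = ℕ.≤-refl
  modulus≤2^gatesSize (gs ▷ g) = begin
    modulus gs * gateModulus g             ≤⟨ ℕ.*-mono-≤ (modulus≤2^gatesSize gs) (gateModulus≤2^gateSize g) ⟩
    2 ^ gatesSize gs * 2 ^ gateSize g      ≡⟨ ℕ.^-distribˡ-+-* 2 (gatesSize gs) (gateSize g) ⟨
    2 ^ (gatesSize gs + gateSize g)        ∎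

module CommonMultiples where

  open import Data.Nat using (ℕ; zero; suc; NonZero; _+_; _*_; _^_; _≤_; _<_; _!; s≤s)
  import Data.Nat.Properties as ℕ
  open import Data.Nat.Properties using (_!≢0; _!*_!≢0)
  open import Data.Nat.Divisibility using (_∣_; ∣m+n∣m⇒∣n; *-monoʳ-∣; *-monoˡ-∣; ∣⇒≤)
  open import Data.Nat.Tactic.RingSolver using (solve-∀)
  open import Relation.Binary.PropositionalEquality

  infix 4 _IsCommonMultipleUpTo_

  _IsCommonMultipleUpTo_ : ℕ → ℕ → Set
  M IsCommonMultipleUpTo N = ∀ i → i < N → suc i ∣ M

  [1+a+b]!∣M*a!*b! : ∀ {M N} → M IsCommonMultipleUpTo N → ∀ a b → a + b < N → suc (a + b) ! ∣ M * a ! * b !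
  [1+a+b]!∣M*a!*b! {M} common zero b b<N =
    subst (λ x → suc b ! ∣ x * b !) (sym (ℕ.*-identityʳ M)) (*-monoˡ-∣ (b !) (common b b<N))
  [1+a+b]!∣M*a!*b! {M} {N} common (suc a) b 1+a+b<N =
    subst (F ∣_) (regroup M a (a !) (b !))
          (∣m+n∣m⇒∣n (subst (F ∣_) (split a b X) (*-monoʳ-∣ (2 + (a + b)) IH₁)) IH₂)
    where
    X = M * a ! * b !
    F = suc (suc (a + b)) !
    split : ∀ a b X → (2 + (a + b)) * X ≡ X * (1 + b) + X * (1 + a)
    split = solve-∀
    regroup : ∀ M a f g → M * f * g * (1 + a) ≡ M * ((1 + a) * f) * g
    regroup = solve-∀
    shuffle : ∀ M f b g → M * f * ((1 + b) * g) ≡ M * f * g * (1 + b)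
    shuffle = solve-∀
    IH₁ : suc (a + b) ! ∣ X
    IH₁ = [1+a+b]!∣M*a!*b! common a b (ℕ.<-trans (ℕ.n<1+n (a + b)) 1+a+b<N)
    IH₂ : suc (suc (a + b)) ! ∣ X * suc b
    IH₂ = subst₂ (λ n x → suc n ! ∣ x) (ℕ.+-suc a b) (shuffle M (a !) b (b !))
            ([1+a+b]!∣M*a!*b! common a (suc b) (subst (_< N) (sym (ℕ.+-suc a b)) 1+a+b<N))

  2^m*m!*m!≤[1+2m]! : ∀ m → 2 ^ m * (m ! * m !) ≤ suc (m + m) !
  2^m*m!*m!≤[1+2m]! zero    = ℕ.≤-refl
  2^m*m!*m!≤[1+2m]! (suc m) = begin
    2 ^ suc m * (suc m ! * suc m !)                   ≡⟨ expand m (2 ^ m) (m !) ⟩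
    (2 + 2 * m) * (1 + m) * (2 ^ m * (m ! * m !))     ≤⟨ ℕ.*-mono-≤ (ℕ.*-monoʳ-≤ (2 + 2 * m) 1+m≤3+2m)
                                                                    (2^m*m!*m!≤[1+2m]! m) ⟩
    (2 + 2 * m) * (3 + 2 * m) * suc (m + m) !         ≡⟨ reorder m (suc (m + m) !) ⟩
    suc (suc (suc (m + m))) !                         ≡⟨ cong (λ n → suc (suc n) !) (ℕ.+-suc m m) ⟨
    suc (suc m + suc m) !                             ∎
    where
    open ℕ.≤-Reasoning
    expand : ∀ m p f → 2 * p * ((1 + m) * f * ((1 + m) * f)) ≡ (2 + 2 * m) * (1 + m) * (p * (f * f))
    expand = solve-∀
    reorder : ∀ m f → (2 + 2 * m) * (3 + 2 * m) * f ≡ (3 + (m + m)) * ((2 + (m + m)) * f)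
    reorder = solve-∀
    1+m≤3+2m : 1 + m ≤ 3 + 2 * m
    1+m≤3+2m = s≤s (ℕ.≤-trans (ℕ.m≤m+n m (m + 0)) (ℕ.m≤n+m (2 * m) 2))

  2^m≤commonMultiple : ∀ {M} m .{{_ : NonZero M}} → M IsCommonMultipleUpTo suc (m + m) → 2 ^ m ≤ M
  2^m≤commonMultiple {M} m {{M≢0}} common = ℕ.*-cancelʳ-≤ (2 ^ m) M (m ! * m !) {{m !* m !≢0}} (begin
    2 ^ m * (m ! * m !)     ≤⟨ 2^m*m!*m!≤[1+2m]! m ⟩
    suc (m + m) !           ≤⟨ ∣⇒≤ {{M*m!*m!≢0}} ([1+a+b]!∣M*a!*b! common m m ℕ.≤-refl) ⟩
    M * m ! * m !           ≡⟨ ℕ.*-assoc M (m !) (m !) ⟩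
    M * (m ! * m !)         ∎)
    where
    open ℕ.≤-Reasoning
    M*m!*m!≢0 : NonZero (M * m ! * m !)
    M*m!*m!≢0 = ℕ.m*n≢0 (M * m !) (m !) {{ℕ.m*n≢0 M (m !) {{M≢0}} {{m !≢0}}}} {{m !≢0}}

module FormulaCombinators where

  open import Data.Nat using (zero; suc; _+_; _*_; _≤_; s≤s)
  import Data.Nat.Properties as ℕ
  open import Data.Nat.Tactic.RingSolver using (solve-∀)
  import Data.Integer as ℤ using (0ℤ; _+_)
  open import Data.Integer.Properties using (+-*-semiring)
  open import Algebra.Properties.Semiring.Sum +-*-semiring using (sum)
  open import Data.Fin using (zero; suc)
  open import Data.Vec.Functional using (Vector; foldr; tail)
  open import Data.Product using (_,_)
  open import Function using (_∘_)
  open import Function.Bundles using (_⇔_; mk⇔; Equivalence)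
  open import Relation.Binary.PropositionalEquality
  open Equivalence using (to; from)

  sumᵗ : ∀ {V K} → Vector (Term V) K → Term V
  sumᵗ = foldr _⊕_ (const ℤ.0ℤ)

  ⟦sumᵗ⟧ : ∀ {V K} (ts : Vector (Term V) K) ρ → ⟦ sumᵗ ts ⟧ᵗ ρ ≡ sum (λ i → ⟦ ts i ⟧ᵗ ρ)
  ⟦sumᵗ⟧ {K = zero}  ts ρ = refl
  ⟦sumᵗ⟧ {K = suc K} ts ρ = cong (ℤ._+_ (⟦ ts zero ⟧ᵗ ρ)) (⟦sumᵗ⟧ (tail ts) ρ)

  allᶠ : ∀ {V K} → Vector (Formula V) K → Formula V
  allᶠ = foldr _∧ᶠ_ tt

  ⟦allᶠ⟧ : ∀ {V K} (φs : Vector (Formula V) K) ρ → ⟦ allᶠ φs ⟧ᶠ ρ ⇔ (∀ i → ⟦ φs i ⟧ᶠ ρ)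
  ⟦allᶠ⟧ {K = zero}  φs ρ = mk⇔ (λ _ ()) (λ _ → _)
  ⟦allᶠ⟧ {K = suc K} φs ρ = mk⇔ (λ (p , ps) → λ { zero → p ; (suc i) → to rest ps i })
                                (λ h → h zero , from rest (h ∘ suc))
    where rest = ⟦allᶠ⟧ (tail φs) ρ

  sumᵗ-size : ∀ {V K} (ts : Vector (Term V) K) B → (∀ i → termSize (ts i) ≤ B) →
              termSize (sumᵗ ts) ≤ 2 + K * suc B
  sumᵗ-size {K = zero}  ts B _     = ℕ.≤-refl
  sumᵗ-size {K = suc K} ts B bound = begin
    suc (termSize (ts zero) + termSize (sumᵗ (tail ts)))
      ≤⟨ s≤s (ℕ.+-mono-≤ (bound zero) (sumᵗ-size (tail ts) B (bound ∘ suc))) ⟩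
    suc (B + (2 + K * suc B))   ≡⟨ regroup K B ⟩
    2 + suc K * suc B           ∎
    where
    open ℕ.≤-Reasoning
    regroup : ∀ K B → suc (B + (2 + K * suc B)) ≡ 2 + suc K * suc B
    regroup = solve-∀

  allᶠ-size : ∀ {V K} (φs : Vector (Formula V) K) B → (∀ i → formulaSize (φs i) ≤ B) →
              formulaSize (allᶠ φs) ≤ 1 + K * suc B
  allᶠ-size {K = zero}  φs B _     = ℕ.≤-refl
  allᶠ-size {K = suc K} φs B bound = begin
    suc (formulaSize (φs zero) + formulaSize (allᶠ (tail φs)))
      ≤⟨ s≤s (ℕ.+-mono-≤ (bound zero) (allᶠ-size (tail φs) B (bound ∘ suc))) ⟩
    suc (B + (1 + K * suc B))   ≡⟨ regroup K B ⟩
    1 + suc K * suc B           ∎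
    where
    open ℕ.≤-Reasoning
    regroup : ∀ K B → suc (B + (1 + K * suc B)) ≡ 1 + suc K * suc B
    regroup = solve-∀

module BinaryDigits where

  open import Data.Nat as ℕ using (zero; suc; _^_; z≤n; s≤s)
  import Data.Nat.Properties as ℕ
  open import Data.Nat.DivMod using (_/_; _%_; m≡m%n+[m/n]*n; m%n<n; m<n*o⇒m/o<n)
  open import Data.Nat.Logarithm using (⌈log₂_⌉; ⌈log₂⌉-mono-≤; ⌈log₂2^n⌉≡n)
  open import Data.Integer using (ℤ; +_; 0ℤ; 1ℤ; _+_; _*_)
  open import Data.Integer.Properties using (+-*-semiring; *-identityˡ; *-assoc; pos-+; pos-*)
  open import Data.Integer.Tactic.RingSolver using (solve-∀)
  open import Algebra.Properties.Semiring.Sum +-*-semiring using (sum; sum-cong-≗; *-distribʳ-sum)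
  open import Data.Fin using (Fin; zero; suc; toℕ)
  import Data.Fin.Properties as Fin
  open import Data.Vec.Functional using (Vector; _∷_)
  open import Data.Product using (∃; _×_; _,_)
  open import Data.Sum using (_⊎_; inj₁; inj₂)
  open import Relation.Binary.PropositionalEquality

  IsBit : ℤ → Set
  IsBit c = c ≡ 0ℤ ⊎ c ≡ 1ℤ

  weight : ∀ {K} → Fin K → ℤ
  weight i = + (2 ^ toℕ i)

  binaryValue : ∀ {K} → Vector ℤ K → ℤ
  binaryValue b = sum (λ i → weight i * b i)

  binaryValue-∷ : ∀ {K} c (b : Vector ℤ K) → binaryValue (c ∷ b) ≡ c + binaryValue b * + 2
  binaryValue-∷ c b = cong₂ _+_ (*-identityˡ c) (begin
    sum (λ i → weight (suc i) * b i)   ≡⟨ sum-cong-≗ (λ i → trans (cong (_* b i) (pos-* 2 (2 ^ toℕ i)))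
                                                                (double (weight i) (b i))) ⟩
    sum (λ i → weight i * b i * + 2)   ≡⟨ *-distribʳ-sum (+ 2) (λ i → weight i * b i) ⟨
    binaryValue b * + 2                ∎)
    where
    open ≡-Reasoning
    double : ∀ w c → + 2 * w * c ≡ w * c * + 2
    double = solve-∀

  binaryValue-*ʳ : ∀ {K} {b z : Vector ℤ K} y → (∀ i → z i ≡ b i * y) →
                   binaryValue z ≡ binaryValue b * y
  binaryValue-*ʳ {b = b} y z≡b*y =
    trans (sum-cong-≗ (λ i → trans (cong (weight i *_) (z≡b*y i)) (sym (*-assoc (weight i) (b i) y))))
          (sym (*-distribʳ-sum y (λ i → weight i * b i)))

  binary-expansion : ∀ K j → j ℕ.< 2 ^ K →
                     ∃ λ (b : Vector ℤ K) → (∀ i → IsBit (b i)) × binaryValue b ≡ + j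
  binary-expansion zero    zero    _        = (λ ()) , (λ ()) , refl
  binary-expansion zero    (suc j) (s≤s ())
  binary-expansion (suc K) j j<2^[1+K]
    with binary-expansion K (j / 2) (m<n*o⇒m/o<n (subst (j ℕ.<_) (ℕ.*-comm 2 (2 ^ K)) j<2^[1+K]))
  ... | b , bits , value≡ = + (j % 2) ∷ b , bit , (begin
    binaryValue (+ (j % 2) ∷ b)       ≡⟨ binaryValue-∷ (+ (j % 2)) b ⟩
    + (j % 2) + binaryValue b * + 2   ≡⟨ cong (λ v → + (j % 2) + v * + 2) value≡ ⟩
    + (j % 2) + + (j / 2) * + 2       ≡⟨ cong (_+_ (+ (j % 2))) (pos-* (j / 2) 2) ⟨
    + (j % 2) + + (j / 2 ℕ.* 2)       ≡⟨ pos-+ (j % 2) (j / 2 ℕ.* 2) ⟨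
    + (j % 2 ℕ.+ j / 2 ℕ.* 2)         ≡⟨ cong +_ (m≡m%n+[m/n]*n j 2) ⟨
    + j                               ∎)
    where
    open ≡-Reasoning
    remainder-isBit : ∀ {r} → r ℕ.< 2 → IsBit (+ r)
    remainder-isBit {0}           _              = inj₁ refl
    remainder-isBit {1}           _              = inj₂ refl
    remainder-isBit {suc (suc _)} (s≤s (s≤s ()))
    bit : ∀ i → IsBit ((+ (j % 2) ∷ b) i)
    bit zero    = remainder-isBit (m%n<n j 2)
    bit (suc i) = bits i

  weight-size : ∀ {K} (i : Fin K) → bitsℤ (weight i) ℕ.≤ 2 ℕ.+ K
  weight-size i = s≤s (s≤s (begin
    ⌈log₂ suc (2 ^ toℕ i) ⌉        ≤⟨ ⌈log₂⌉-mono-≤ (ℕ.^-monoʳ-< 2 (s≤s (s≤s z≤n)) (ℕ.n<1+n (toℕ i))) ⟩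
    ⌈log₂ 2 ^ suc (toℕ i) ⌉        ≡⟨ ⌈log₂2^n⌉≡n (suc (toℕ i)) ⟩
    suc (toℕ i)                    ≤⟨ Fin.toℕ<n i ⟩
    _                              ∎))
    where open ℕ.≤-Reasoning

module DivisionSpec where

  open FloorDivision using (/ℕ-unique)
  open FormulaCombinators
  open BinaryDigits

  open import Data.Nat using (ℕ; suc)
  open import Data.Integer using (ℤ; +_; 0ℤ; 1ℤ; _+_; _*_; _≤_; _<_; _/ℕ_)
  import Data.Integer as ℤ using (suc)
  open import Data.Integer.Properties using (*-identityˡ; *-zeroˡ; ≮⇒≥; ≤⇒≯)
  open import Data.Integer.DivMod using ([n/ℕd]*d≤n; n<s[n/ℕd]*d)
  open import Data.Integer.Tactic.RingSolver using (solve-∀)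
  open import Data.Fin using (Fin; zero; suc)
  open import Data.Vec.Functional using (Vector; _∷_)
  open import Data.Product using (_×_; _,_; proj₁; proj₂)
  open import Data.Sum using (_⊎_; inj₁; inj₂)
  open import Function using (_∘_)
  open import Function.Bundles using (_⇔_; mk⇔; Equivalence)
  open import Relation.Binary.PropositionalEquality
  open Equivalence using (to; from)

  productDigitᶠ : ∀ {V} → Term V → Term V → Term V → Formula V
  productDigitᶠ b z y = ((b =ᶠ const 0ℤ) ∧ᶠ (z =ᶠ const 0ℤ)) ∨ᶠ ((b =ᶠ const 1ℤ) ∧ᶠ (z =ᶠ y))

  ⟦productDigitᶠ⟧ : ∀ {V} (b z y : Term V) ρ →
                    ⟦ productDigitᶠ b z y ⟧ᶠ ρ ⇔ (IsBit (⟦ b ⟧ᵗ ρ) × ⟦ z ⟧ᵗ ρ ≡ ⟦ b ⟧ᵗ ρ * ⟦ y ⟧ᵗ ρ)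
  ⟦productDigitᶠ⟧ b z y ρ = mk⇔
    (λ { (inj₁ (b≡0 , z≡0)) → inj₁ b≡0 , trans z≡0 (sym (times₀ b≡0))
       ; (inj₂ (b≡1 , z≡y)) → inj₂ b≡1 , trans z≡y (sym (times₁ b≡1)) })
    (λ { (inj₁ b≡0 , z≡b*y) → inj₁ (b≡0 , trans z≡b*y (times₀ b≡0))
       ; (inj₂ b≡1 , z≡b*y) → inj₂ (b≡1 , trans z≡b*y (times₁ b≡1)) })
    where
    times₀ : ⟦ b ⟧ᵗ ρ ≡ 0ℤ → ⟦ b ⟧ᵗ ρ * ⟦ y ⟧ᵗ ρ ≡ 0ℤ
    times₀ b≡0 = trans (cong (_* ⟦ y ⟧ᵗ ρ) b≡0) (*-zeroˡ (⟦ y ⟧ᵗ ρ))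
    times₁ : ⟦ b ⟧ᵗ ρ ≡ 1ℤ → ⟦ b ⟧ᵗ ρ * ⟦ y ⟧ᵗ ρ ≡ ⟦ y ⟧ᵗ ρ
    times₁ b≡1 = trans (cong (_* ⟦ y ⟧ᵗ ρ) b≡1) (*-identityˡ (⟦ y ⟧ᵗ ρ))

  Var : ℕ → Set
  Var K = Fin (suc K) ⊎ Fin (suc K)

  module _ {K : ℕ} where

    xᵛ yᵛ : Term (Var K)
    xᵛ = var (inj₁ zero)
    yᵛ = var (inj₂ zero)

    bᵛ zᵛ : Fin K → Term (Var K)
    bᵛ i = var (inj₁ (suc i))
    zᵛ i = var (inj₂ (suc i))

    weightedSumᵗ : (Fin K → Term (Var K)) → Term (Var K)
    weightedSumᵗ ts = sumᵗ (λ i → scale (weight i) (ts i))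

    lowerᵗ upperᵗ : Term (Var K)
    lowerᵗ = yᵛ ⊕ weightedSumᵗ zᵛ
    upperᵗ = lowerᵗ ⊕ (const 1ℤ ⊕ weightedSumᵗ bᵛ)

  -- The auxiliary outputs zᵢ = bᵢ·y make (1 + J)·y a linear term.
  divisionFormula : ∀ K → Formula (Var K)
  divisionFormula K =
    allᶠ (λ i → productDigitᶠ (bᵛ i) (zᵛ i) yᵛ) ∧ᶠ ((¬ᶠ (xᵛ <ᶠ lowerᵗ)) ∧ᶠ (xᵛ <ᶠ upperᵗ))

  divisionSpec : ℕ → Spec
  divisionSpec K = record { nIn = suc K ; nOut = suc K ; φ = divisionFormula K }

  ⟦lowerᵗ⟧ : ∀ {K} (ρ : Var K → ℤ) → (∀ i → ρ (inj₂ (suc i)) ≡ ρ (inj₁ (suc i)) * ρ (inj₂ zero)) →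
            ⟦ lowerᵗ ⟧ᵗ ρ ≡ ρ (inj₂ zero) * (1ℤ + binaryValue (ρ ∘ inj₁ ∘ suc))
  ⟦lowerᵗ⟧ ρ products =
    trans (cong (_+_ y) (trans (⟦sumᵗ⟧ (λ i → scale (weight i) (zᵛ i)) ρ) (binaryValue-*ʳ y products)))
          (factor y (binaryValue (ρ ∘ inj₁ ∘ suc)))
    where
    y = ρ (inj₂ zero)
    factor : ∀ y J → y + J * y ≡ y * (1ℤ + J)
    factor = solve-∀

  ⟦upperᵗ⟧ : ∀ {K} (ρ : Var K → ℤ) → (∀ i → ρ (inj₂ (suc i)) ≡ ρ (inj₁ (suc i)) * ρ (inj₂ zero)) →
            ⟦ upperᵗ ⟧ᵗ ρ ≡ ℤ.suc (ρ (inj₂ zero)) * (1ℤ + binaryValue (ρ ∘ inj₁ ∘ suc))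
  ⟦upperᵗ⟧ ρ products =
    trans (cong₂ (λ l s → l + (1ℤ + s)) (⟦lowerᵗ⟧ ρ products) (⟦sumᵗ⟧ (λ i → scale (weight i) (bᵛ i)) ρ))
          (factor (ρ (inj₂ zero)) _)
    where
    factor : ∀ y d → y * d + d ≡ (1ℤ + y) * d
    factor = solve-∀

  DivisionConstraints : ∀ {K} → ℤ → Vector ℤ K → ℤ → Vector ℤ K → Set
  DivisionConstraints x b y z = (∀ i → IsBit (b i)) × (∀ i → z i ≡ b i * y) ×
                                 y * (1ℤ + binaryValue b) ≤ x × x < ℤ.suc y * (1ℤ + binaryValue b)

  ⟦divisionFormula⟧ : ∀ {K} (ρ : Var K → ℤ) → ⟦ divisionFormula K ⟧ᶠ ρ ⇔
                      DivisionConstraints (ρ (inj₁ zero)) (ρ ∘ inj₁ ∘ suc) (ρ (inj₂ zero)) (ρ ∘ inj₂ ∘ suc)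
  ⟦divisionFormula⟧ ρ = mk⇔
    (λ (digits , lower , upper) →
       let products = λ i → proj₂ (digit digits i) in
       proj₁ ∘ digit digits , products ,
       subst (_≤ x) (⟦lowerᵗ⟧ ρ products) (≮⇒≥ lower) , subst (x <_) (⟦upperᵗ⟧ ρ products) upper)
    (λ (bits , products , lo , hi) →
       from (⟦allᶠ⟧ _ ρ) (λ i → from (⟦productDigitᶠ⟧ (bᵛ i) (zᵛ i) yᵛ ρ) (bits i , products i)) ,
       ≤⇒≯ (subst (_≤ x) (sym (⟦lowerᵗ⟧ ρ products)) lo) , subst (x <_) (sym (⟦upperᵗ⟧ ρ products)) hi)
    where
    x = ρ (inj₁ zero)
    digit = λ digits i → to (⟦productDigitᶠ⟧ (bᵛ i) (zᵛ i) yᵛ ρ) (to (⟦allᶠ⟧ _ ρ) digits i)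

  skolem-computes-floor : ∀ {K j} {b : Vector ℤ K} {f} → IsSkolem (divisionSpec K) f →
                          (∀ i → IsBit (b i)) → binaryValue b ≡ + j → ∀ x → f (x ∷ b) zero ≡ x /ℕ suc j
  skolem-computes-floor {j = j} {b} {f} skolem bits value≡ x =
    sym (/ℕ-unique x (suc j) (subst (λ d → y * d ≤ x) divisor≡ lo)
                             (subst (λ d → x < ℤ.suc y * d) divisor≡ hi))
    where
    y = f (x ∷ b) zero
    q = x /ℕ suc j
    divisor≡ : 1ℤ + binaryValue b ≡ + suc j
    divisor≡ = cong (_+_ 1ℤ) value≡
    solution : holds (divisionSpec _) (x ∷ b) (q ∷ λ i → b i * q)
    solution = from (⟦divisionFormula⟧ _)
      (bits , (λ _ → refl) , subst (λ d → q * d ≤ x) (sym divisor≡) ([n/ℕd]*d≤n x (suc j)) ,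
                             subst (λ d → x < ℤ.suc q * d) (sym divisor≡) (n<s[n/ℕd]*d x (suc j)))
    constraints = to (⟦divisionFormula⟧ _) (skolem (x ∷ b) (_ , solution))
    lo = proj₁ (proj₂ (proj₂ constraints))
    hi = proj₂ (proj₂ (proj₂ constraints))

module DivisionSpecSize where

  open FormulaCombinators
  open BinaryDigits
  open DivisionSpec

  open import Data.Nat using (suc; _+_; _*_; _^_; _≤_; s≤s)
  import Data.Nat.Properties as ℕ
  open import Data.Nat.Tactic.RingSolver using (solve-∀)
  open import Relation.Binary.PropositionalEquality using (_≡_)

  divisionSpec-size : ∀ K → specSize (divisionSpec K) ≤ 3 * K * K + 37 * K + 25
  divisionSpec-size K = begin
    specSize (divisionSpec K)                ≡⟨ shape K A Z B ⟩
    18 + 2 * K + A + 2 * Z + B               ≤⟨ ℕ.+-mono-≤ (ℕ.+-mono-≤ (ℕ.+-monoʳ-≤ (18 + 2 * K) A≤)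
                                                                         (ℕ.*-monoʳ-≤ 2 Z≤)) B≤ ⟩
    18 + 2 * K + (1 + K * 20) + 2 * S + S    ≡⟨ polynomial K ⟩
    3 * K * K + 37 * K + 25                  ∎
    where
    open ℕ.≤-Reasoning
    A = formulaSize (allᶠ (λ i → productDigitᶠ (bᵛ {K} i) (zᵛ i) yᵛ))
    Z = termSize (weightedSumᵗ (zᵛ {K}))
    B = termSize (weightedSumᵗ (bᵛ {K}))
    S = 2 + K * (5 + K)
    shape : ∀ K A Z B → suc K + suc K + suc (A + suc ((5 + Z) + (3 + ((2 + Z) + (4 + B))))) ≡
                        18 + 2 * K + A + 2 * Z + B
    shape = solve-∀
    polynomial : ∀ K → 18 + 2 * K + (1 + K * 20) + 2 * (2 + K * (5 + K)) + (2 + K * (5 + K)) ≡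
                       3 * K * K + 37 * K + 25
    polynomial = solve-∀
    term≤ : ∀ i → suc (bitsℤ (weight {K} i) + 1) ≤ 4 + K
    term≤ i = s≤s (ℕ.≤-trans (ℕ.+-monoˡ-≤ 1 (weight-size i)) (ℕ.≤-reflexive (ℕ.+-comm (2 + K) 1)))
    A≤ : A ≤ 1 + K * 20
    A≤ = allᶠ-size (λ i → productDigitᶠ (bᵛ i) (zᵛ i) yᵛ) 19 (λ i → ℕ.≤-refl)
    Z≤ : Z ≤ S
    Z≤ = sumᵗ-size (λ i → scale (weight i) (zᵛ i)) (4 + K) term≤
    B≤ : B ≤ S
    B≤ = sumᵗ-size (λ i → scale (weight i) (bᵛ i)) (4 + K) term≤

  divisionSpec[2+n]-size : ∀ n → specSize (divisionSpec (2 + n)) ≤ 111 * suc n ^ 2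
  divisionSpec[2+n]-size n = begin
    specSize (divisionSpec (2 + n))                             ≤⟨ divisionSpec-size (2 + n) ⟩
    3 * (2 + n) * (2 + n) + 37 * (2 + n) + 25                   ≤⟨ ℕ.m≤m+n _ (108 * n * n + 173 * n) ⟩
    3 * (2 + n) * (2 + n) + 37 * (2 + n) + 25 + (108 * n * n + 173 * n) ≡⟨ slack n ⟩
    111 * suc n ^ 2                                             ∎
    where
    open ℕ.≤-Reasoning
    slack : ∀ n → 3 * (2 + n) * (2 + n) + 37 * (2 + n) + 25 + (108 * n * n + 173 * n) ≡
                  111 * (suc n * (suc n * 1))
    slack = solve-∀

module SkolemCircuits where

  open EventuallyAffineFunctions
  open CircuitsAlongRays
  open CommonMultiples
  open BinaryDigits
  open DivisionSpec
  open import Data.Nat as ℕ using (ℕ; zero; suc; _+_; _*_; _^_; _≤_)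
  import Data.Nat.Properties as ℕ
  open import Data.Nat.Logarithm using (⌊log₂_⌋; ⌊log₂⌋-mono-≤; ⌊log₂[2^n]⌋≡n)
  open import Data.Nat.Tactic.RingSolver using (solve-∀)
  open import Data.Integer as ℤ using (ℤ; +_; 0ℤ; 1ℤ; _/ℕ_)
  import Data.Integer.Properties as ℤ
  open import Data.Fin using (Fin; zero; suc)
  open import Data.Vec.Functional using (_∷_)
  open import Data.Product using (_,_)
  open import Relation.Binary.PropositionalEquality

  skolemCircuit-modulusIsCommonMultiple : ∀ {K} (C : Circuit (suc K) (suc K)) →
                                          IsSkolem (divisionSpec K) (evalCircuit C) →
                                          modulus (Circuit.gates C) IsCommonMultipleUpTo 2 ^ K
  skolemCircuit-modulusIsCommonMultiple {K} C skolem j j<2^K with binary-expansion K j j<2^K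
  ... | b , bits , value≡ =
    floor-eventuallyAffine⇒∣ P (suc j) (eventuallyAffine-cong (always computes-floor) output-eventuallyAffine)
    where
    P = modulus (Circuit.gates C)
    ray : ℕ → Fin (suc K) → ℤ
    ray t = + t ∷ b
    ray-eventuallyAffine : ∀ i → EventuallyAffine (λ t → ray t i)
    ray-eventuallyAffine zero    =
      1ℤ , 0ℤ , always λ t → sym (trans (ℤ.+-identityʳ (1ℤ ℤ.* + t)) (ℤ.*-identityˡ (+ t)))
    ray-eventuallyAffine (suc i) = const-eventuallyAffine (b i)
    output-eventuallyAffine : EventuallyAffine (λ t → evalCircuit C (ray (P * t)) zero)
    output-eventuallyAffine =
      wires-eventuallyAffine (Circuit.gates C) ray-eventuallyAffine (Circuit.out C zero)
    computes-floor : ∀ t → evalCircuit C (ray (P * t)) zero ≡ + (P * t) /ℕ suc j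
    computes-floor t = skolem-computes-floor skolem bits value≡ (+ (P * t))

  2^n≤skolemCircuitSize : ∀ n (C : Circuit (3 + n) (3 + n)) →
                          IsSkolem (divisionSpec (2 + n)) (evalCircuit C) → 2 ^ n ≤ circuitSize C
  2^n≤skolemCircuitSize n C skolem = begin
    m                          ≡⟨ ⌊log₂[2^n]⌋≡n m ⟨
    ⌊log₂ 2 ^ m ⌋              ≤⟨ ⌊log₂⌋-mono-≤ (ℕ.≤-trans 2^m≤P (modulus≤2^gatesSize gs)) ⟩
    ⌊log₂ 2 ^ gatesSize gs ⌋   ≡⟨ ⌊log₂[2^n]⌋≡n (gatesSize gs) ⟩
    gatesSize gs               ≤⟨ ℕ.m≤n+m (gatesSize gs) (3 + n) ⟩
    circuitSize C              ∎
    where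
    open ℕ.≤-Reasoning
    gs = Circuit.gates C
    m = 2 ^ n
    quadruple : ∀ m → (m + m) + (m + m) ≡ 2 * (2 * m)
    quadruple = solve-∀
    1+2m≤2^[2+n] : 1 + (m + m) ≤ 2 ^ (2 + n)
    1+2m≤2^[2+n] = ℕ.≤-trans (ℕ.+-monoˡ-≤ (m + m) (ℕ.≤-trans (ℕ.m^n>0 2 n) (ℕ.m≤m+n m m)))
                             (ℕ.≤-reflexive (quadruple m))
    2^m≤P : 2 ^ m ≤ modulus gs
    2^m≤P = 2^m≤commonMultiple m {{modulus-nonZero gs}} λ i i<1+2m →
              skolemCircuit-modulusIsCommonMultiple C skolem i (ℕ.<-≤-trans i<1+2m 1+2m≤2^[2+n])

open SkolemCircuits using (2^n≤skolemCircuitSize)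
open DivisionSpec using (divisionSpec)
open DivisionSpecSize using (divisionSpec[2+n]-size)
open import Data.Nat using (ℕ; _+_; _*_; _^_; _≤_; suc)
open import Data.Nat.Properties using (^-identityʳ)
open import Data.Product using (Σ; _×_; _,_)
open import Relation.Binary.PropositionalEquality using (subst; sym)

mainTheorem2 : Σ (ℕ → Spec) λ μ → (Σ ℕ λ c → Σ ℕ λ d → ∀ n → specSize (μ n) ≤ c * (suc n) ^ d) × (Σ ℕ λ a → Σ ℕ λ N → ∀ n → N ≤ n → (C : Circuit (Spec.nIn (μ n)) (Spec.nOut (μ n))) → IsSkolem (μ n) (evalCircuit C) → 2 ^ n ≤ (circuitSize C) ^ (suc a))
mainTheorem2 =
  (λ n → divisionSpec (2 + n)) ,
  (111 , 2 , divisionSpec[2+n]-size) ,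
  (0 , 0 , λ n _ C skolem →
    subst (2 ^ n ≤_) (sym (^-identityʳ (circuitSize C))) (2^n≤skolemCircuitSize n C skolem))
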